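{- Let $n\geq 3$ and $1\leq t<n$ be integers. Then $h(\overrightarrow{C}_{n^2-n-t}[\overrightarrow{C}_n])\geq n^2$.
   Context: $\overrightarrow{C}_m$ is the directed cycle with vertex set $\mathbb{Z}_m$ and arcs $j\to j+1$. The lexicographic product $D[H]$ has vertex set $V(D)\times V(H)$, with an arc from $(u,a)$ to $(v,b)$ iff $uv\in A(D)$, or $u=v$ and $ab\in A(H)$. A harmonious coloring with $k$ colors is a surjection $V(D)\to[k]$ such that each color class spans no arc and for every ordered pair $(i,j)$ of distinct colors there is at most one arc from a vertex colored $i$ to a vertex colored $j$; $h(D)$ is the smallest such $k$. -}

module Defs where

open import Data.Nat using (ℕ; suc; _≤_)
open import Data.Fin using (Fin; toℕ)
open import Data.Product using (_×_; _,_; Σ; ∃)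
open import Data.Sum using (_⊎_)
open import Relation.Binary.PropositionalEquality using (_≡_; _≢_)
open import Relation.Nullary using (¬_)

record Digraph : Set₁ where
  field
    V   : Set
    Arc : V → V → Set
open Digraph public

-- Directed cycle C_m on ℤ_m (represented by Fin m), arcs j → j+1 (mod m).
-- j → j+1 mod m written out: either toℕ j = toℕ i + 1, or i = m-1 and j = 0.
cycle : ℕ → Digraph
cycle m = record
  { V   = Fin m
  ; Arc = λ i j → (toℕ j ≡ suc (toℕ i)) ⊎ (suc (toℕ i) ≡ m × toℕ j ≡ 0) }

lex : Digraph → Digraph → Digraph
lex D H = record
  { V   = V D × V H
  ; Arc = λ { (u , a) (v , b) → Arc D u v ⊎ (u ≡ v × Arc H a b) } }

record Harmonious (D : Digraph) (k : ℕ) : Set where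
  field
    col        : V D → Fin k
    surjective : (i : Fin k) → ∃ λ v → col v ≡ i
    proper     : ∀ {u v} → Arc D u v → col u ≢ col v
    atMostOne  : ∀ {u v u' v'} → Arc D u v → Arc D u' v' →
                 col u ≡ col u' → col v ≡ col v' → col u ≢ col v →
                 (u ≡ u' × v ≡ v')

hAtLeast : Digraph → ℕ → Set
hAtLeast D N = ∀ k → Harmonious D k → N ≤ k

{-# OPTIONS --safe #-}
-- A harmonious colouring with k colours has a colour class of at least
-- ⌈N/k⌉ vertices, where N is the number of vertices. Every vertex of
-- C_m[C_n] has n + 1 distinct out-neighbours, and for a colour class S the
-- |S|(n + 1) arcs leaving S must end in pairwise distinct colours other than
-- the colour of S, so k ≥ 1 + |S|(n + 1). If k ≤ n² then, since
-- m = n² − n − t ≥ (n − 1)², some class has n − 1 vertices, giving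
-- k ≥ 1 + (n − 1)(n + 1) = n².
module Submission where

open import Defs
open import Data.Nat using (ℕ; zero; suc; _+_; _*_; _∸_; _≤_; _<_; z≤n; s≤s; _≤?_; _<?_)
open import Data.Nat.Properties
open import Data.Nat.Tactic.RingSolver using (solve-∀)
open import Data.Fin using (Fin; zero; suc; toℕ; fromℕ<; inject≤; punchOut)
open import Data.Fin.Properties
  using (toℕ<n; toℕ-fromℕ<; inject≤-injective; punchOut-injective; injective⇒≤; ¬∀⟶∃¬; *↔×)
  renaming (_≟_ to _≟ᶠ_; suc-injective to suc-injectiveᶠ)
open import Data.Product using (_×_; _,_; Σ-syntax; ∃-syntax; proj₁; proj₂)
open import Data.Sum using (inj₁; inj₂)
open import Function using (_∘_; const; Injective; Injection)
open import Function.Properties.Inverse using (↔⇒↣)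
open import Relation.Nullary using (Dec; yes; no; contradiction)
open import Relation.Binary.PropositionalEquality
open import Algebra.Properties.CommutativeMonoid.Sum +-0-commutativeMonoid using (sum; ∑-distrib-+)

≤-sum : ∀ {k} (g : Fin k → ℕ) c → g c ≤ sum g
≤-sum g zero    = m≤m+n (g zero) _
≤-sum g (suc c) = ≤-trans (≤-sum (g ∘ suc) c) (m≤n+m _ (g zero))

sum-≤ : ∀ {k} (g : Fin k → ℕ) s → (∀ c → g c ≤ s) → sum g ≤ k * s
sum-≤ {zero}  g s g≤s = z≤n
sum-≤ {suc k} g s g≤s = +-mono-≤ (g≤s zero) (sum-≤ (g ∘ suc) s (g≤s ∘ suc))

sum-large-term : ∀ {k} (g : Fin k → ℕ) s → k * s < sum g → ∃[ c ] s < g c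
sum-large-term {k} g s ks<sum with ¬∀⟶∃¬ k (λ c → g c ≤ s) (λ c → g c ≤? s)
                                         (λ g≤s → <⇒≱ ks<sum (sum-≤ g s g≤s))
... | c , g≰s = c , ≰⇒> g≰s

record FibreEnumeration {N k : ℕ} (f : Fin N → Fin k) : Set where
  field
    size             : Fin k → ℕ
    member           : ∀ c → Fin (size c) → Fin N
    member-injective : ∀ c → Injective _≡_ _≡_ (member c)
    member-fibre     : ∀ c i → f (member c i) ≡ c
    covers           : N ≤ sum size

indicator : ∀ {P : Set} → Dec P → ℕ
indicator (yes _) = 1
indicator (no _)  = 0

indicator-yes : ∀ {P : Set} (d : Dec P) → P → indicator d ≡ 1
indicator-yes (yes _) _ = refl
indicator-yes (no ¬p) p = contradiction p ¬p

fibreEnumeration : ∀ {N k} (f : Fin N → Fin k) → FibreEnumeration f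
fibreEnumeration {zero} f = record
  { size = const 0 ; member = λ _ () ; member-injective = λ _ {} ; member-fibre = λ _ ()
  ; covers = z≤n }
fibreEnumeration {suc N} f = record
  { size             = λ c → counted c + size c
  ; member           = λ c → member′ c (f zero ≟ᶠ c)
  ; member-injective = λ c → member′-injective c (f zero ≟ᶠ c)
  ; member-fibre     = λ c → member′-fibre c (f zero ≟ᶠ c)
  ; covers           = begin
      suc N                                          ≡⟨ cong (_+ N) (indicator-yes (f zero ≟ᶠ f zero) refl) ⟨
      counted (f zero) + N                           ≤⟨ +-mono-≤ (≤-sum counted (f zero)) covers ⟩
      sum counted + sum size                         ≡⟨ ∑-distrib-+ counted size ⟨
      sum (λ c → counted c + size c)                 ∎
  }
  where
  open FibreEnumeration (fibreEnumeration (f ∘ suc))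
  open ≤-Reasoning

  counted : Fin _ → ℕ
  counted c = indicator (f zero ≟ᶠ c)

  member′ : ∀ c (d : Dec (f zero ≡ c)) → Fin (indicator d + size c) → Fin (suc N)
  member′ c (yes _) zero    = zero
  member′ c (yes _) (suc i) = suc (member c i)
  member′ c (no _)  i       = suc (member c i)

  member′-injective : ∀ c d → Injective _≡_ _≡_ (member′ c d)
  member′-injective c (yes _) {zero}  {zero}  _ = refl
  member′-injective c (yes _) {suc i} {suc j} e = cong suc (member-injective c (suc-injectiveᶠ e))
  member′-injective c (no _)  {i}     {j}     e = member-injective c (suc-injectiveᶠ e)

  member′-fibre : ∀ c d i → f (member′ c d i) ≡ c
  member′-fibre c (yes f₀≡c) zero    = f₀≡c
  member′-fibre c (yes _)    (suc i) = member-fibre c i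
  member′-fibre c (no _)     i       = member-fibre c i

pigeonhole-fibre : ∀ {N k} (f : Fin N → Fin k) s → k * s < N →
                   ∃[ c ] Σ[ g ∈ (Fin (suc s) → Fin N) ] Injective _≡_ _≡_ g × (∀ i → f (g i) ≡ c)
pigeonhole-fibre f s ks<N =
  let c , s<size = sum-large-term size s (<-≤-trans ks<N covers)
  in  c , (λ i → member c (inject≤ i s<size))
        , (λ e → inject≤-injective s<size s<size _ _ (member-injective c e))
        , (λ i → member-fibre c (inject≤ i s<size))
  where open FibreEnumeration (fibreEnumeration f)

product-injective⇒≤ : ∀ {s d r} {h : Fin s × Fin d → Fin r} → Injective _≡_ _≡_ h → s * d ≤ r
product-injective⇒≤ {s} {d} h-injective =
  injective⇒≤ (Injection.injective (↔⇒↣ (*↔× {s} {d})) ∘ h-injective)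

record OutRegular (D : Digraph) (d : ℕ) : Set where
  field
    out           : V D → Fin d → V D
    out-arc       : ∀ v j → Arc D v (out v j)
    out-injective : ∀ v → Injective _≡_ _≡_ (out v)

module _ {D : Digraph} {d : ℕ} (R : OutRegular D d) where
  open OutRegular R

  colourClass-bound : ∀ {k s} (H : Harmonious D k) (c : Fin k) {g : Fin s → V D} →
                      Injective _≡_ _≡_ g → (∀ i → Harmonious.col H (g i) ≡ c) → suc (s * d) ≤ k
  colourClass-bound {suc k} {s} H c {g} g-injective g∈c =
    s≤s (product-injective⇒≤ {h = target} target-injective)
    where
    open Harmonious H

    c≢target : ∀ i j → c ≢ col (out (g i) j)
    c≢target i j c≡ = proper (out-arc (g i) j) (trans (g∈c i) c≡)

    target : Fin s × Fin d → Fin k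
    target (i , j) = punchOut (c≢target i j)

    target-injective : Injective _≡_ _≡_ target
    target-injective {i , j} {i′ , j′} e
      with g-equal , out-equal ← atMostOne (out-arc (g i) j) (out-arc (g i′) j′)
                                   (trans (g∈c i) (sym (g∈c i′)))
                                   (punchOut-injective (c≢target i j) (c≢target i′ j′) e)
                                   (c≢target i j ∘ trans (sym (g∈c i)))
      with refl ← g-injective g-equal
      = cong (i ,_) (out-injective (g i) out-equal)

  harmonious-≥ : ∀ {k N} (H : Harmonious D k) {e : Fin N → V D} → Injective _≡_ _≡_ e →
                 ∀ s → k * s < N → suc (suc s * d) ≤ k
  harmonious-≥ H {e} e-injective s ks<N =
    let c , g , g-injective , g∈c = pigeonhole-fibre (Harmonious.col H ∘ e) s ks<N
    in  colourClass-bound H c (g-injective ∘ e-injective) g∈c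

cycle-successor : ∀ {m} (i : Fin m) → ∃[ j ] Arc (cycle m) i j
cycle-successor {suc m} i with suc (toℕ i) <? suc m
... | yes 1+i<m = fromℕ< 1+i<m , inj₁ (toℕ-fromℕ< 1+i<m)
... | no  1+i≮m = zero , inj₂ (≤-antisym (toℕ<n i) (≮⇒≥ 1+i≮m) , refl)

cycle-loopless : ∀ {m} → 2 ≤ m → ∀ {i j} → Arc (cycle m) i j → i ≢ j
cycle-loopless _   (inj₁ j≡1+i)         refl = 1+n≢n (sym j≡1+i)
cycle-loopless 2≤m (inj₂ (1+i≡m , i≡0)) refl =
  contradiction (subst (2 ≤_) (trans (sym 1+i≡m) (cong suc i≡0)) 2≤m) λ { (s≤s ()) }

lex-cycle-outRegular : ∀ {m n} → 2 ≤ m → OutRegular (lex (cycle m) (cycle n)) (suc n)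
lex-cycle-outRegular {m} {n} 2≤m = record
  { out = out ; out-arc = out-arc ; out-injective = out-injective }
  where
  out : Fin m × Fin n → Fin (suc n) → Fin m × Fin n
  out (u , a) zero    = u , proj₁ (cycle-successor a)
  out (u , a) (suc b) = proj₁ (cycle-successor u) , b

  out-arc : ∀ v j → Arc (lex (cycle m) (cycle n)) v (out v j)
  out-arc (u , a) zero    = inj₂ (refl , proj₂ (cycle-successor a))
  out-arc (u , a) (suc b) = inj₁ (proj₂ (cycle-successor u))

  u≢successor : ∀ u → u ≢ proj₁ (cycle-successor u)
  u≢successor u = cycle-loopless 2≤m (proj₂ (cycle-successor u))

  out-injective : ∀ v → Injective _≡_ _≡_ (out v)
  out-injective (u , a) {zero}  {zero}   _ = refl
  out-injective (u , a) {zero}  {suc _}  e = contradiction (cong proj₁ e) (u≢successor u)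
  out-injective (u , a) {suc _} {zero}   e = contradiction (cong proj₁ (sym e)) (u≢successor u)
  out-injective (u , a) {suc _} {suc _}  e = cong (suc ∘ proj₂) e

m*m≤[1+m]*[1+m]∸[1+m]∸n : ∀ m n → n ≤ m → m * m ≤ suc m * suc m ∸ suc m ∸ n
m*m≤[1+m]*[1+m]∸[1+m]∸n m n n≤m = begin
  m * m                           ≡⟨ m+n∸n≡m (m * m) m ⟨
  m * m + m ∸ m                   ≤⟨ ∸-monoʳ-≤ (m * m + m) n≤m ⟩
  m * m + m ∸ n                   ≡⟨ cong (_∸ n) (m+n∸n≡m (m * m + m) (suc m)) ⟨
  m * m + m + suc m ∸ suc m ∸ n   ≡⟨ cong (λ x → x ∸ suc m ∸ n) (square-expansion m) ⟩
  suc m * suc m ∸ suc m ∸ n       ∎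
  where
  open ≤-Reasoning
  square-expansion : ∀ m → m * m + m + suc m ≡ suc m * suc m
  square-expansion = solve-∀

k*n<m*[2+n] : ∀ n k m → suc n * suc n ≤ m → k ≤ suc (suc n) * suc (suc n) → k * n < m * suc (suc n)
k*n<m*[2+n] n k m [1+n]²≤m k≤[2+n]² = begin-strict
  k * n               ≤⟨ *-monoˡ-≤ n k≤[2+n]² ⟩
  N * N * n           <⟨ m<m+n (N * N * n) (s≤s z≤n) ⟩
  N * N * n + N       ≡⟨ square-identity n ⟩
  suc n * suc n * N   ≤⟨ *-monoˡ-≤ N [1+n]²≤m ⟩
  m * N               ∎
  where
  open ≤-Reasoning
  N = suc (suc n)
  square-identity : ∀ n → suc (suc n) * suc (suc n) * n + suc (suc n) ≡ suc n * suc n * suc (suc n)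
  square-identity = solve-∀

1+[1+n]*[3+n]≡[2+n]*[2+n] : ∀ n → suc (suc n * suc (suc (suc n))) ≡ suc (suc n) * suc (suc n)
1+[1+n]*[3+n]≡[2+n]*[2+n] = solve-∀

corollary11 : (n t : ℕ) → 3 ≤ n → 1 ≤ t → t < n →
    hAtLeast (lex (cycle (n * n ∸ n ∸ t)) (cycle n)) (n * n)
corollary11 n@(suc r@(suc q)) t (s≤s (s≤s (s≤s _))) _ (s≤s t≤r) k H with ≤-total k (n * n)
... | inj₂ n²≤k = n²≤k
... | inj₁ k≤n² =
  subst (_≤ k) (1+[1+n]*[3+n]≡[2+n]*[2+n] q)
    (harmonious-≥ (lex-cycle-outRegular 2≤m) H (Injection.injective (↔⇒↣ *↔×)) q
      (k*n<m*[2+n] q k m r²≤m k≤n²))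
  where
  m = n * n ∸ n ∸ t
  r²≤m : r * r ≤ m
  r²≤m = m*m≤[1+m]*[1+m]∸[1+m]∸n r t t≤r
  2≤m : 2 ≤ m
  2≤m = ≤-trans (s≤s (s≤s z≤n)) r²≤m
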